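{- Let $G$ be a C0P-graph whose partition $(C_1,C_2,U)$ (with respect to a fixed vertex ordering as in the context) has $U=\emptyset$, let $\{i,j\}=\{1,2\}$, and let $S\subseteq C_i$. Then $|N_G[v]\cap S|\geq |S|-1$ for every $v\in C_j$ if and only if $S$ is a stable set of the graph $H_i$.
   Context: For a graph $G$ with vertices $v_1,\dots,v_n$, the augmented adjacency matrix $M^*(G)=(m^*_{ij})$ has $m^*_{ij}=1$ if $i=j$ or $v_iv_j\in E(G)$, and $0$ otherwise. $G$ is a C0P-graph if its vertices can be ordered $v_1,\dots,v_n$ so that in every column of $M^*(G)$ the $0$ entries occur in consecutive rows. Fix such an ordering. The zeros of column $j$ lie either all below the diagonal or all above. $C_1$ is the set of $v_j$ whose column has zeros, all below the diagonal; $C_2$ the set of $v_j$ whose column has zeros, all above the diagonal; $U$ the set of $v_j$ whose column has no zeros. For $v\in C_1\cup C_2$ let $I(v)$ be the set of row indices of the zeros in the column of $v$ (a nonempty set of consecutive integers, i.e. an integer interval). $H_i$ is the interval graph with vertex set $C_i$ in which distinct $v,w$ are adjacent iff $I(v)\cap I(w)\neq\emptyset$ (equivalently, some vertex of $G$ is adjacent to neither $v$ nor $w$). A stable set is a set of pairwise nonadjacent vertices. $N_G[v]=N_G(v)\cup\{v\}$. (In the paper's terminology, the left-hand condition says $S$ $(|S|-1)$-dominates $G_j=G[C_j]$.) -}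

module Defs where

open import Data.Nat using (ℕ)
open import Data.Bool using (Bool; true; false; _∨_)
open import Data.Fin using (Fin; _≤_; _<_; _≟_)
open import Data.Fin.Subset using (Subset; _∈_)
open import Data.Vec using (tabulate)
open import Data.Product using (Σ; ∃; _×_)
open import Relation.Nullary using (¬_; ⌊_⌋)
open import Relation.Binary.PropositionalEquality using (_≡_; _≢_)

-- A finite simple graph on the vertices v_1..v_n, represented by Fin n
-- (v_k ↔ index k-1); the vertex ordering of the context is the order of Fin n.
record Graph (n : ℕ) : Set where
  field
    adj   : Fin n → Fin n → Bool
    sym   : ∀ u v → adj u v ≡ adj v u
    irrefl : ∀ v → adj v v ≡ false
open Graph public

M* : ∀ {n} → Graph n → Fin n → Fin n → Bool
M* G r c = ⌊ r ≟ c ⌋ ∨ adj G r c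

Zero : ∀ {n} → Graph n → Fin n → Fin n → Set
Zero G r c = M* G r c ≡ false

-- The fixed ordering witnesses that G is a C0P-graph: in every column the
-- zero entries occur in consecutive rows.
IsC0POrdering : ∀ {n} → Graph n → Set
IsC0POrdering {n} G = ∀ (c a b d : Fin n) →
  Zero G a c → Zero G d c → a ≤ b → b ≤ d → Zero G b c

InU : ∀ {n} → Graph n → Fin n → Set
InU {n} G v = ∀ (r : Fin n) → ¬ Zero G r v

InC1 : ∀ {n} → Graph n → Fin n → Set
InC1 {n} G v = (∃ λ (r : Fin n) → Zero G r v) × (∀ (r : Fin n) → Zero G r v → v < r)

InC2 : ∀ {n} → Graph n → Fin n → Set
InC2 {n} G v = (∃ λ (r : Fin n) → Zero G r v) × (∀ (r : Fin n) → Zero G r v → r < v)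

data Side : Set where
  one two : Side

other : Side → Side
other one = two
other two = one

InC : ∀ {n} → Side → Graph n → Fin n → Set
InC one = InC1
InC two = InC2

-- Adjacency in the interval graph H_i: distinct v,w ∈ C_i with I(v) ∩ I(w) ≠ ∅.
HAdj : ∀ {n} → Side → Graph n → Fin n → Fin n → Set
HAdj {n} i G v w = InC i G v × InC i G w × v ≢ w ×
  (∃ λ (r : Fin n) → Zero G r v × Zero G r w)

StableIn : ∀ {n} → Side → Graph n → Subset n → Set
StableIn {n} i G S = ∀ (v w : Fin n) → v ∈ S → w ∈ S → ¬ HAdj i G v w

N[_] : ∀ {n} → Graph n → Fin n → Subset n
N[_] G v = tabulate λ u → ⌊ u ≟ v ⌋ ∨ adj G v u

-- A vertex w ∈ S is missing from N_G[v] exactly when M*(G) has a 0 in row v,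
-- column w, so the degree condition at v says that row v carries a zero of at
-- most one vertex of S. Two vertices of S are adjacent in H_i exactly when some
-- row carries zeros of both, and by the consecutive-zeros property such a row
-- is a vertex of C_j.
module Submission where

open import Defs hiding (sym)
open import Data.Nat using (ℕ; zero; suc; _+_; _∸_; z≤n; s≤s; z<s; _<_; _≤?_)
  renaming (_≤_ to _≤ℕ_)
open import Data.Nat.Properties
  using (≤-refl; ≤-pred; ≤-reflexive; ≤-trans; <-≤-trans; +-suc; +-identityʳ; +-monoˡ-≤;
         m∸n≤m; m+n∸n≡m; m<m+n; <⇒≱; >⇒≢; ≰⇒>; <⇒≤)
open import Data.Fin using (Fin; _≟_)
open import Data.Fin.Subset
  using (Subset; _∈_; _∉_; _∩_; _─_; _-_; ⁅_⁆; ∣_∣; Nonempty; inside; outside)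
open import Data.Fin.Subset.Properties
  using (nonempty?; Empty-unique; ∣⊥∣≡0; x∈⁅y⁆⇒x≡y; x∉⁅y⁆⇒x≢y; ∣⁅x⁆∣≡1;
         p⊆q⇒∣p∣≤∣q∣; ∣p∩q∣≤∣p∣; p─q⊆p; x∈p∧x∉q⇒x∈p─q; x∈p∧x≢y⇒x∈p-y;
         x∈p⇒∣p-x∣<∣p∣; drop-there)
open import Data.Empty using (⊥-elim)
open import Data.Product using (_×_; _,_)
open import Data.Vec using ([]; _∷_; here; there; lookup)
open import Data.Vec.Properties using ([]=⇒lookup; lookup⇒[]=; lookup∘tabulate)
open import Data.Bool using (true; _∨_)
open import Data.Bool.Properties using (¬-not; not-¬)
open import Function using (const; _∘_)
open import Function.Bundles using (_⇔_; mk⇔; Equivalence)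
open import Function.Properties.Equivalence using () renaming (trans to ⇔-trans)
open import Relation.Nullary using (¬_; yes; no; ⌊_⌋; contradiction)
open import Relation.Nullary.Decidable using (decidable-stable)
open import Relation.Binary.PropositionalEquality
  using (_≡_; _≢_; refl; sym; trans; cong; cong₂; subst)

open Equivalence using (to; from)

private
  variable
    n : ℕ
    x y : Fin n
    p q : Subset n

m+n∸1≤m⇔n≤1 : ∀ m n → m + n ∸ 1 ≤ℕ m ⇔ n ≤ℕ 1
m+n∸1≤m⇔n≤1 m zero =
  mk⇔ (const z≤n) (const (≤-trans (m∸n≤m (m + 0) 1) (≤-reflexive (+-identityʳ m))))
m+n∸1≤m⇔n≤1 m (suc zero) = mk⇔ (const ≤-refl) (const (≤-reflexive (m+n∸n≡m m 1)))
m+n∸1≤m⇔n≤1 m (suc (suc k)) = mk⇔ absurd λ { (s≤s ()) }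
  where
  absurd : m + suc (suc k) ∸ 1 ≤ℕ m → suc (suc k) ≤ℕ 1
  absurd h = contradiction (subst (_≤ℕ m) (cong (_∸ 1) (+-suc m (suc k))) h)
                           (<⇒≱ (m<m+n m z<s))

∣p∣≡∣q∩p∣+∣p─q∣ : ∀ (p q : Subset n) → ∣ p ∣ ≡ ∣ q ∩ p ∣ + ∣ p ─ q ∣
∣p∣≡∣q∩p∣+∣p─q∣ []            []            = refl
∣p∣≡∣q∩p∣+∣p─q∣ (inside  ∷ p) (inside  ∷ q) = cong suc (∣p∣≡∣q∩p∣+∣p─q∣ p q)
∣p∣≡∣q∩p∣+∣p─q∣ (inside  ∷ p) (outside ∷ q) =
  trans (cong suc (∣p∣≡∣q∩p∣+∣p─q∣ p q)) (sym (+-suc ∣ q ∩ p ∣ ∣ p ─ q ∣))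
∣p∣≡∣q∩p∣+∣p─q∣ (outside ∷ p) (inside  ∷ q) = ∣p∣≡∣q∩p∣+∣p─q∣ p q
∣p∣≡∣q∩p∣+∣p─q∣ (outside ∷ p) (outside ∷ q) = ∣p∣≡∣q∩p∣+∣p─q∣ p q

x∈p─q⇒x∉q : x ∈ p ─ q → x ∉ q
x∈p─q⇒x∉q {p = _ ∷ _} {q = outside ∷ _} here = λ ()
x∈p─q⇒x∉q {p = _ ∷ _} {q = _ ∷ _} (there x∈p─q) =
  x∈p─q⇒x∉q x∈p─q ∘ drop-there

Subsingleton : Subset n → Set
Subsingleton p = ∀ {x y} → x ∈ p → y ∈ p → x ≡ y

0<∣p∣⇒Nonempty : ∀ {n} (p : Subset n) → 0 < ∣ p ∣ → Nonempty p
0<∣p∣⇒Nonempty {n} p 0<∣p∣ with nonempty? p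
... | yes p≢∅ = p≢∅
... | no  p≡∅ = contradiction (trans (cong ∣_∣ (Empty-unique p≡∅)) (∣⊥∣≡0 n)) (>⇒≢ 0<∣p∣)

x∈p⇒0<∣p∣ : x ∈ p → 0 < ∣ p ∣
x∈p⇒0<∣p∣ {x = x} x∈p = <-≤-trans (≤-reflexive (sym (∣⁅x⁆∣≡1 x)))
  (p⊆q⇒∣p∣≤∣q∣ λ y∈⁅x⁆ → subst (_∈ _) (sym (x∈⁅y⁆⇒x≡y x y∈⁅x⁆)) x∈p)

x∈p∧y∈p∧x≢y⇒2≤∣p∣ : x ∈ p → y ∈ p → x ≢ y → 2 ≤ℕ ∣ p ∣
x∈p∧y∈p∧x≢y⇒2≤∣p∣ x∈p y∈p x≢y =
  ≤-trans (s≤s (x∈p⇒0<∣p∣ (x∈p∧x≢y⇒x∈p-y y∈p (x≢y ∘ sym)))) (x∈p⇒∣p-x∣<∣p∣ x∈p)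

∣p∣≤1+∣p-x∣ : ∀ (p : Subset n) x → ∣ p ∣ ≤ℕ suc ∣ p - x ∣
∣p∣≤1+∣p-x∣ p x = ≤-trans (≤-reflexive (∣p∣≡∣q∩p∣+∣p─q∣ p ⁅ x ⁆))
  (+-monoˡ-≤ ∣ p - x ∣ (≤-trans (∣p∩q∣≤∣p∣ ⁅ x ⁆ p) (≤-reflexive (∣⁅x⁆∣≡1 x))))

2≤∣p∣⇒¬Subsingleton : ∀ (p : Subset n) → 2 ≤ℕ ∣ p ∣ → ¬ Subsingleton p
2≤∣p∣⇒¬Subsingleton p 2≤∣p∣ p-sub with 0<∣p∣⇒Nonempty p (≤-trans (s≤s z≤n) 2≤∣p∣)
... | x , x∈p with 0<∣p∣⇒Nonempty (p - x) (≤-pred (≤-trans 2≤∣p∣ (∣p∣≤1+∣p-x∣ p x)))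
... | y , y∈p-x = x∉⁅y⁆⇒x≢y (x∈p─q⇒x∉q y∈p-x) (p-sub (p─q⊆p p ⁅ x ⁆ y∈p-x) x∈p)

∣p∣≤1⇔Subsingleton : ∀ (p : Subset n) → ∣ p ∣ ≤ℕ 1 ⇔ Subsingleton p
∣p∣≤1⇔Subsingleton p = mk⇔ ≤1⇒sub sub⇒≤1
  where
  ≤1⇒sub : ∣ p ∣ ≤ℕ 1 → Subsingleton p
  ≤1⇒sub ∣p∣≤1 {x} {y} x∈p y∈p = decidable-stable (x ≟ y)
    λ x≢y → <⇒≱ (x∈p∧y∈p∧x≢y⇒2≤∣p∣ x∈p y∈p x≢y) ∣p∣≤1
  sub⇒≤1 : Subsingleton p → ∣ p ∣ ≤ℕ 1
  sub⇒≤1 p-sub with ∣ p ∣ ≤? 1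
  ... | yes ∣p∣≤1 = ∣p∣≤1
  ... | no  ∣p∣≰1 = ⊥-elim (2≤∣p∣⇒¬Subsingleton p (≰⇒> ∣p∣≰1) p-sub)

∣p∣∸1≤∣q∩p∣⇔Subsingleton[p─q] : ∀ (p q : Subset n) →
  ∣ p ∣ ∸ 1 ≤ℕ ∣ q ∩ p ∣ ⇔ Subsingleton (p ─ q)
∣p∣∸1≤∣q∩p∣⇔Subsingleton[p─q] p q = ⇔-trans
  (subst (λ k → k ∸ 1 ≤ℕ ∣ q ∩ p ∣ ⇔ ∣ p ─ q ∣ ≤ℕ 1) (sym (∣p∣≡∣q∩p∣+∣p─q∣ p q))
         (m+n∸1≤m⇔n≤1 ∣ q ∩ p ∣ ∣ p ─ q ∣))
  (∣p∣≤1⇔Subsingleton (p ─ q))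

⌊≟⌋-sym : ∀ (x y : Fin n) → ⌊ x ≟ y ⌋ ≡ ⌊ y ≟ x ⌋
⌊≟⌋-sym x y with x ≟ y | y ≟ x
... | yes _   | yes _   = refl
... | no  _   | no  _   = refl
... | yes x≡y | no  y≢x = contradiction (sym x≡y) y≢x
... | no  x≢y | yes y≡x = contradiction (sym y≡x) x≢y

module _ (G : Graph n) where

  M*-sym : ∀ r c → M* G r c ≡ M* G c r
  M*-sym r c = cong₂ _∨_ (⌊≟⌋-sym r c) (Graph.sym G r c)

  M*-diag : ∀ r → M* G r r ≡ true
  M*-diag r with r ≟ r
  ... | yes _   = refl
  ... | no  r≢r = contradiction refl r≢r

  Zero-sym : ∀ {r c} → Zero G r c → Zero G c r
  Zero-sym {r} {c} = trans (M*-sym c r)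

  ¬Zero-diag : ∀ r → ¬ Zero G r r
  ¬Zero-diag r z with () ← trans (sym (M*-diag r)) z

  lookup-N[] : ∀ v x → lookup (N[ G ] v) x ≡ M* G v x
  lookup-N[] v x = trans (lookup∘tabulate _ x) (cong (_∨ adj G v x) (⌊≟⌋-sym x v))

  ∉N[]⇔Zero : ∀ v x → x ∉ N[ G ] v ⇔ Zero G v x
  ∉N[]⇔Zero v x = mk⇔
    (λ x∉N → ¬-not (x∉N ∘ lookup⇒[]= x (N[ G ] v) ∘ trans (lookup-N[] v x)))
    (λ z x∈N → not-¬ z (trans (sym (lookup-N[] v x)) ([]=⇒lookup x∈N)))

  ∈─N[]⇔Zero : ∀ (S : Subset n) v x → x ∈ S ─ N[ G ] v ⇔ (x ∈ S × Zero G v x)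
  ∈─N[]⇔Zero S v x = mk⇔
    (λ x∈S─N → p─q⊆p S (N[ G ] v) x∈S─N , to (∉N[]⇔Zero v x) (x∈p─q⇒x∉q x∈S─N))
    (λ (x∈S , z) → x∈p∧x∉q⇒x∈p─q x∈S (from (∉N[]⇔Zero v x) z))

  -- Column r has its zero in row w on one side of the diagonal; a zero on the other
  -- side would, by consecutiveness, put a zero on the diagonal.
  Zero⇒InC-other : IsC0POrdering G → ∀ i {w r} → InC i G w → Zero G r w → InC (other i) G r
  Zero⇒InC-other c0p one {w} {r} (_ , below) z =
    (w , Zero-sym z) , λ d zd → ≰⇒> λ r≤d →
      ¬Zero-diag r (c0p r w r d (Zero-sym z) zd (<⇒≤ (below r z)) r≤d)
  Zero⇒InC-other c0p two {w} {r} (_ , above) z =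
    (w , Zero-sym z) , λ d zd → ≰⇒> λ d≤r →
      ¬Zero-diag r (c0p r d r w zd (Zero-sym z) d≤r (<⇒≤ (above r z)))

  StableIn⇒Subsingleton[─N[]] : ∀ i (S : Subset n) → (∀ v → v ∈ S → InC i G v) →
    StableIn i G S → ∀ r → Subsingleton (S ─ N[ G ] r)
  StableIn⇒Subsingleton[─N[]] i S S⊆Cᵢ stable r {x} {y} x∈S─N y∈S─N
    with to (∈─N[]⇔Zero S r x) x∈S─N | to (∈─N[]⇔Zero S r y) y∈S─N
  ... | x∈S , zx | y∈S , zy = decidable-stable (x ≟ y) λ x≢y →
    stable x y x∈S y∈S (S⊆Cᵢ x x∈S , S⊆Cᵢ y y∈S , x≢y , r , zx , zy)

  Subsingleton[─N[]]⇒StableIn : IsC0POrdering G → ∀ i (S : Subset n) →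
    (∀ r → InC (other i) G r → Subsingleton (S ─ N[ G ] r)) → StableIn i G S
  Subsingleton[─N[]]⇒StableIn c0p i S sub x y x∈S y∈S (x∈Cᵢ , _ , x≢y , r , zx , zy) =
    x≢y (sub r (Zero⇒InC-other c0p i x∈Cᵢ zx)
               (from (∈─N[]⇔Zero S r x) (x∈S , zx)) (from (∈─N[]⇔Zero S r y) (y∈S , zy)))

proposition2 : ∀ {n : ℕ} (G : Graph n) → IsC0POrdering G →
    (∀ (v : Fin n) → ¬ InU G v) →
    ∀ (i : Side) (S : Subset n) → (∀ (v : Fin n) → v ∈ S → InC i G v) →
    ((∀ (v : Fin n) → InC (other i) G v → ∣ S ∣ ∸ 1 ≤ℕ ∣ N[ G ] v ∩ S ∣) → StableIn i G S)
    × (StableIn i G S → ∀ (v : Fin n) → InC (other i) G v → ∣ S ∣ ∸ 1 ≤ℕ ∣ N[ G ] v ∩ S ∣)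
proposition2 G c0p _ i S S⊆Cᵢ =
    (λ degree → Subsingleton[─N[]]⇒StableIn G c0p i S λ r r∈Cⱼ → to (degree⇔ r) (degree r r∈Cⱼ))
  , (λ stable v _ → from (degree⇔ v) (StableIn⇒Subsingleton[─N[]] G i S S⊆Cᵢ stable v))
  where
  degree⇔ : ∀ v → ∣ S ∣ ∸ 1 ≤ℕ ∣ N[ G ] v ∩ S ∣ ⇔ Subsingleton (S ─ N[ G ] v)
  degree⇔ v = ∣p∣∸1≤∣q∩p∣⇔Subsingleton[p─q] S (N[ G ] v)
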